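{- Let $n\ge1$, let $s\in\{0,1\}^{n'}$ be a non-empty sequence with $1\le n'\le n$, let $j\in\{1,\dots,n'\}$, and let $s'=1^{j}2^{n-j}$, where $2$ denotes a character not in $\{0,1\}$. Let $k$ be the number of $1$'s among the first $j$ characters $s[1],\dots,s[j]$ of $s$. Then the Levenshtein distance satisfies $d_L(s,s')=n-k$.
   Context: The Levenshtein (edit) distance $d_L(x,y)$ is the minimal number of single-symbol insertions, deletions and substitutions transforming $x$ into $y$. For a character $c$, $c^m$ denotes $c$ repeated $m$ times. -}

module Defs where

open import Data.Nat using (ℕ; zero; suc; _≤_)
open import Data.List using (List; []; _∷_; _++_; take; replicate; length; filter)
open import Data.Fin using (Fin)
import Data.Fin as Fin
open import Data.Product using (_×_; ∃-syntax)
open import Relation.Binary.PropositionalEquality using (_≡_)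

-- Alphabet {0,1,2}: Fin 3, with 2 the extra character.
Sym : Set
Sym = Fin 3

data Step {A : Set} : List A → List A → Set where
  ins : (u v : List A) (a : A) → Step (u ++ v) (u ++ a ∷ v)
  del : (u v : List A) (a : A) → Step (u ++ a ∷ v) (u ++ v)
  sub : (u v : List A) (a b : A) → Step (u ++ a ∷ v) (u ++ b ∷ v)

data EditSeq {A : Set} : List A → List A → ℕ → Set where
  done : (x : List A) → EditSeq x x zero
  step : {x y z : List A} {m : ℕ} → Step x y → EditSeq y z m → EditSeq x z (suc m)

LevDist : {A : Set} → List A → List A → ℕ → Set
LevDist x y d = EditSeq x y d × (∀ m → EditSeq x y m → d ≤ m)

ones : List Sym → ℕ
ones [] = zero
ones (Fin.zero ∷ l) = ones l
ones (Fin.suc Fin.zero ∷ l) = suc (ones l)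
ones (Fin.suc (Fin.suc _) ∷ l) = ones l

{-# OPTIONS --safe #-}
-- The distance is pinned between two bounds. Upward: keep the 1's of s at
-- the positions they already occupy in 1^j and substitute or insert every
-- other symbol, n - k edits. Downward: the Wagner–Fischer recursion lev is a
-- lower bound for the length of any edit sequence (one edit changes it by at
-- most 1), and an induction along that recursion shows lev s s' ≥ n - k, as
-- only a 1 of s inside its first j positions can be matched for free, and no
-- symbol of s matches a 2.
module Submission where

open import Defs
open import Data.Nat using (ℕ; zero; suc; _+_; _∸_; _≤_; _⊓_; z≤n; s≤s)
open import Data.Nat.Properties
open import Data.List using (List; []; _∷_; take; replicate; length; _++_)
open import Data.List.Properties using (length-replicate)
open import Data.List.Relation.Unary.All using (All; []; _∷_)
open import Data.Fin using (zero; suc)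
import Data.Fin as Fin
open import Data.Product using (_,_)
open import Relation.Binary.Definitions using (DecidableEquality)
open import Relation.Nullary using (yes; no; contradiction)
open import Relation.Binary.PropositionalEquality
  using (_≡_; _≢_; refl; sym; trans; cong; cong₂; subst)

LevDist-intro : ∀ {A : Set} {x y : List A} {d} →
  EditSeq x y d → (∀ {m} → EditSeq x y m → d ≤ m) → LevDist x y d
LevDist-intro e minimal = e , λ _ → minimal

suc-∸-≤ : ∀ m n → suc m ∸ n ≤ suc (m ∸ n)
suc-∸-≤ m n = m≤n+o⇒m∸n≤o (suc m) n
  (≤-trans (s≤s (m≤n+m∸n m n)) (≤-reflexive (sym (+-suc n (m ∸ n)))))

∸-≤-suc-∸ : ∀ m {o p} → p ≤ suc o → m ∸ o ≤ suc (m ∸ p)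
∸-≤-suc-∸ m {p = p} p≤1+o = ≤-trans (∸-monoʳ-≤ (suc m) p≤1+o) (suc-∸-≤ m p)

⊓₃-mono-≤ : ∀ {p q r p' q' r'} → p ≤ p' → q ≤ q' → r ≤ r' → p ⊓ (q ⊓ r) ≤ p' ⊓ (q' ⊓ r')
⊓₃-mono-≤ p≤ q≤ r≤ = ⊓-mono-≤ p≤ (⊓-mono-≤ q≤ r≤)

length-insert : ∀ {A : Set} (u v : List A) a → length (u ++ a ∷ v) ≡ suc (length (u ++ v))
length-insert []      v a = refl
length-insert (c ∷ u) v a = cong suc (length-insert u v a)

module _ {A : Set} where

  Step-cons : ∀ {x y : List A} c → Step x y → Step (c ∷ x) (c ∷ y)
  Step-cons c (ins u v a)   = ins (c ∷ u) v a
  Step-cons c (del u v a)   = del (c ∷ u) v a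
  Step-cons c (sub u v a b) = sub (c ∷ u) v a b

  EditSeq-cons : ∀ {x y : List A} {m} c → EditSeq x y m → EditSeq (c ∷ x) (c ∷ y) m
  EditSeq-cons c (done x)   = done (c ∷ x)
  EditSeq-cons c (step s e) = step (Step-cons c s) (EditSeq-cons c e)

  EditSeq-subst-head : ∀ {x y : List A} {m} a b → EditSeq x y m → EditSeq (a ∷ x) (b ∷ y) (suc m)
  EditSeq-subst-head {x} a b e = step (sub [] x a b) (EditSeq-cons b e)

  EditSeq-insert-all : ∀ (y : List A) → EditSeq [] y (length y)
  EditSeq-insert-all []      = done []
  EditSeq-insert-all (b ∷ y) = step (ins [] [] b) (EditSeq-cons b (EditSeq-insert-all y))

module Levenshtein {A : Set} (_≟_ : DecidableEquality A) where

  mismatch : A → A → ℕ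
  mismatch a b with a ≟ b
  ... | yes _ = 0
  ... | no  _ = 1

  mismatch≤1 : ∀ a b → mismatch a b ≤ 1
  mismatch≤1 a b with a ≟ b
  ... | yes _ = z≤n
  ... | no  _ = ≤-refl

  mismatch-refl : ∀ a → mismatch a a ≡ 0
  mismatch-refl a with a ≟ a
  ... | yes _   = refl
  ... | no  a≢a = contradiction refl a≢a

  mismatch-≢ : ∀ {a b} → a ≢ b → mismatch a b ≡ 1
  mismatch-≢ {a} {b} a≢b with a ≟ b
  ... | yes a≡b = contradiction a≡b a≢b
  ... | no  _   = refl

  lev : List A → List A → ℕ
  lev []      y       = length y
  lev (a ∷ x) []      = suc (length x)
  lev (a ∷ x) (b ∷ y) = (mismatch a b + lev x y) ⊓ (suc (lev x (b ∷ y)) ⊓ suc (lev (a ∷ x) y))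

  lev-refl : ∀ x → lev x x ≡ 0
  lev-refl []      = refl
  lev-refl (a ∷ x) = n≤0⇒n≡0 (≤-trans (m⊓n≤m _ _)
    (≤-reflexive (cong₂ _+_ (mismatch-refl a) (lev-refl x))))

  lev-[]ʳ : ∀ x → lev x [] ≡ length x
  lev-[]ʳ []      = refl
  lev-[]ʳ (a ∷ x) = refl

  lev-consʳ : ∀ x b z → lev x (b ∷ z) ≤ suc (lev x z)
  lev-consʳ []      b z = ≤-refl
  lev-consʳ (a ∷ x) b z = ≤-trans (m⊓n≤n _ _) (m⊓n≤n _ _)

  lev-del : ∀ u v a z → lev (u ++ a ∷ v) z ≤ suc (lev (u ++ v) z)
  lev-del []      v a []      = s≤s (≤-reflexive (sym (lev-[]ʳ v)))
  lev-del []      v a (b ∷ z) = ≤-trans (m⊓n≤n _ _) (m⊓n≤m _ _)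
  lev-del (c ∷ u) v a []      = s≤s (≤-reflexive (length-insert u v a))
  lev-del (c ∷ u) v a (b ∷ z) = ⊓₃-mono-≤
    (≤-trans (+-monoʳ-≤ (mismatch c b) (lev-del u v a z)) (≤-reflexive (+-suc _ _)))
    (s≤s (lev-del u v a (b ∷ z)))
    (s≤s (lev-del (c ∷ u) v a z))

  lev-ins : ∀ u v a z → lev (u ++ v) z ≤ suc (lev (u ++ a ∷ v) z)
  lev-ins []      v a []      = ≤-trans (≤-reflexive (lev-[]ʳ v)) (≤-trans (n≤1+n _) (n≤1+n _))
  lev-ins []      v a (b ∷ z) = ⊓-glb
    (≤-trans (lev-consʳ v b z) (s≤s (m≤n+m _ _)))
    (⊓-glb (≤-trans (n≤1+n _) (n≤1+n _))
           (≤-trans (lev-consʳ v b z) (s≤s (lev-ins [] v a z))))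
  lev-ins (c ∷ u) v a []      =
    s≤s (≤-trans (n≤1+n _) (≤-trans (≤-reflexive (sym (length-insert u v a))) (n≤1+n _)))
  lev-ins (c ∷ u) v a (b ∷ z) = ⊓₃-mono-≤
    (≤-trans (+-monoʳ-≤ (mismatch c b) (lev-ins u v a z)) (≤-reflexive (+-suc _ _)))
    (s≤s (lev-ins u v a (b ∷ z)))
    (s≤s (lev-ins (c ∷ u) v a z))

  lev-sub : ∀ u v a b z → lev (u ++ a ∷ v) z ≤ suc (lev (u ++ b ∷ v) z)
  lev-sub []      v a b []      = n≤1+n _
  lev-sub []      v a b (c ∷ z) = ⊓₃-mono-≤
    (≤-trans (+-monoˡ-≤ (lev v z) (mismatch≤1 a c)) (s≤s (m≤n+m _ _)))
    (n≤1+n _)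
    (s≤s (lev-sub [] v a b z))
  lev-sub (d ∷ u) v a b []      = s≤s (≤-trans
    (≤-reflexive (trans (length-insert u v a) (sym (length-insert u v b)))) (n≤1+n _))
  lev-sub (d ∷ u) v a b (c ∷ z) = ⊓₃-mono-≤
    (≤-trans (+-monoʳ-≤ (mismatch d c) (lev-sub u v a b z)) (≤-reflexive (+-suc _ _)))
    (s≤s (lev-sub u v a b (c ∷ z)))
    (s≤s (lev-sub (d ∷ u) v a b z))

  lev-Step : ∀ {x y} z → Step x y → lev x z ≤ suc (lev y z)
  lev-Step z (ins u v a)   = lev-ins u v a z
  lev-Step z (del u v a)   = lev-del u v a z
  lev-Step z (sub u v a b) = lev-sub u v a b z

  lev≤EditSeq : ∀ {x z m} → EditSeq x z m → lev x z ≤ m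
  lev≤EditSeq (done x)           = ≤-reflexive (lev-refl x)
  lev≤EditSeq {z = z} (step s e) = ≤-trans (lev-Step z s) (s≤s (lev≤EditSeq e))

  lev-replicate-absent : ∀ {b} x r → All (_≢ b) x → r ≤ lev x (replicate r b)
  lev-replicate-absent x       zero    _        = z≤n
  lev-replicate-absent []      (suc r) _        = s≤s (≤-reflexive (sym (length-replicate r)))
  lev-replicate-absent {b} (a ∷ x) (suc r) (a≢b ∷ x∌b) = ⊓-glb
    (subst (λ c → suc r ≤ c + lev x (replicate r b)) (sym (mismatch-≢ a≢b))
      (s≤s (lev-replicate-absent x r x∌b)))
    (⊓-glb (≤-trans (lev-replicate-absent x (suc r) x∌b) (n≤1+n _))
           (s≤s (lev-replicate-absent (a ∷ x) r (a≢b ∷ x∌b))))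

open Levenshtein (Fin._≟_ {3})

one two : Sym
one = suc zero
two = suc (suc zero)

onesTwos : ℕ → ℕ → List Sym
onesTwos j r = replicate j one ++ replicate r two

length-onesTwos : ∀ j r → length (onesTwos j r) ≡ j + r
length-onesTwos zero    r = length-replicate r
length-onesTwos (suc j) r = cong suc (length-onesTwos j r)

EditSeq-[]-onesTwos : ∀ j r → EditSeq [] (onesTwos j r) (j + r)
EditSeq-[]-onesTwos j r =
  subst (EditSeq [] (onesTwos j r)) (length-onesTwos j r) (EditSeq-insert-all _)

ones-cons-≤ : ∀ a l → ones (a ∷ l) ≤ suc (ones l)
ones-cons-≤ zero             l = n≤1+n _
ones-cons-≤ (suc zero)       l = ≤-refl
ones-cons-≤ (suc (suc zero)) l = n≤1+n _

ones-cons-≥ : ∀ a l → ones l ≤ ones (a ∷ l)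
ones-cons-≥ zero             l = ≤-refl
ones-cons-≥ (suc zero)       l = n≤1+n _
ones-cons-≥ (suc (suc zero)) l = ≤-refl

ones-take-≤ : ∀ j x → ones (take j x) ≤ j
ones-take-≤ zero    x       = z≤n
ones-take-≤ (suc j) []      = z≤n
ones-take-≤ (suc j) (a ∷ x) = ≤-trans (ones-cons-≤ a _) (s≤s (ones-take-≤ j x))

ones-take-suc-≥ : ∀ j x → ones (take j x) ≤ ones (take (suc j) x)
ones-take-suc-≥ zero    x                    = z≤n
ones-take-suc-≥ (suc j) []                   = z≤n
ones-take-suc-≥ (suc j) (zero ∷ x)           = ones-take-suc-≥ j x
ones-take-suc-≥ (suc j) (suc zero ∷ x)       = s≤s (ones-take-suc-≥ j x)
ones-take-suc-≥ (suc j) (suc (suc zero) ∷ x) = ones-take-suc-≥ j x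

ones-take-suc-≤ : ∀ j x → ones (take (suc j) x) ≤ suc (ones (take j x))
ones-take-suc-≤ zero    []                   = z≤n
ones-take-suc-≤ (suc j) []                   = z≤n
ones-take-suc-≤ zero    (a ∷ x)              = ones-cons-≤ a []
ones-take-suc-≤ (suc j) (zero ∷ x)           = ones-take-suc-≤ j x
ones-take-suc-≤ (suc j) (suc zero ∷ x)       = s≤s (ones-take-suc-≤ j x)
ones-take-suc-≤ (suc j) (suc (suc zero) ∷ x) = ones-take-suc-≤ j x

replace-head-by-one : ∀ b x j r → EditSeq x (onesTwos j r) ((j + r) ∸ ones (take j x)) →
  EditSeq (b ∷ x) (onesTwos (suc j) r) (suc (j + r) ∸ ones (take j x))
replace-head-by-one b x j r e = subst (EditSeq (b ∷ x) (onesTwos (suc j) r))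
  (sym (+-∸-assoc 1 (≤-trans (ones-take-≤ j x) (m≤m+n j r))))
  (EditSeq-subst-head b one e)

EditSeq-onesTwos : ∀ x j r → length x ≤ j + r →
  EditSeq x (onesTwos j r) ((j + r) ∸ ones (take j x))
EditSeq-onesTwos []      zero    r _ = EditSeq-[]-onesTwos zero r
EditSeq-onesTwos []      (suc j) r _ = EditSeq-[]-onesTwos (suc j) r
EditSeq-onesTwos (a ∷ x) zero (suc r) (s≤s h) =
  EditSeq-subst-head a two (EditSeq-onesTwos x zero r h)
EditSeq-onesTwos (zero ∷ x)           (suc j) r (s≤s h) =
  replace-head-by-one zero x j r (EditSeq-onesTwos x j r h)
EditSeq-onesTwos (suc zero ∷ x)       (suc j) r (s≤s h) =
  EditSeq-cons one (EditSeq-onesTwos x j r h)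
EditSeq-onesTwos (suc (suc zero) ∷ x) (suc j) r (s≤s h) =
  replace-head-by-one two x j r (EditSeq-onesTwos x j r h)

lev-onesTwos-match : ∀ a x j r {l} → a ≢ two → (j + r) ∸ ones (take j x) ≤ l →
  suc (j + r) ∸ ones (a ∷ take j x) ≤ mismatch a one + l
lev-onesTwos-match zero             x j r _   ih = ≤-trans (suc-∸-≤ (j + r) (ones (take j x))) (s≤s ih)
lev-onesTwos-match (suc zero)       x j r _   ih = ih
lev-onesTwos-match (suc (suc zero)) x j r a≢2 _  = contradiction refl a≢2

lev-onesTwos-≥ : ∀ x j r → All (_≢ two) x →
  (j + r) ∸ ones (take j x) ≤ lev x (onesTwos j r)
lev-onesTwos-≥ x       zero    r x∌2 = lev-replicate-absent x r x∌2
lev-onesTwos-≥ []      (suc j) r _   = ≤-reflexive (sym (length-onesTwos (suc j) r))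
lev-onesTwos-≥ (a ∷ x) (suc j) r (a≢2 ∷ x∌2) = ⊓-glb
  (lev-onesTwos-match a x j r a≢2 (lev-onesTwos-≥ x j r x∌2))
  (⊓-glb (delete-head (lev-onesTwos-≥ x (suc j) r x∌2))
         (insert-one (lev-onesTwos-≥ (a ∷ x) j r (a≢2 ∷ x∌2))))
  where
  k : ℕ
  k = ones (a ∷ take j x)

  delete-head : ∀ {l} → suc (j + r) ∸ ones (take (suc j) x) ≤ l → suc (j + r) ∸ k ≤ suc l
  delete-head ih = ≤-trans
    (∸-≤-suc-∸ (suc (j + r)) (≤-trans (ones-take-suc-≤ j x) (s≤s (ones-cons-≥ a _))))
    (s≤s ih)

  insert-one : ∀ {l} → (j + r) ∸ ones (take j (a ∷ x)) ≤ l → suc (j + r) ∸ k ≤ suc l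
  insert-one ih = ≤-trans (∸-monoʳ-≤ (suc (j + r)) (ones-take-suc-≥ j (a ∷ x)))
    (≤-trans (suc-∸-≤ (j + r) (ones (take j (a ∷ x)))) (s≤s ih))

LevDist-onesTwos : ∀ x j r → length x ≤ j + r → All (_≢ two) x →
  LevDist x (onesTwos j r) ((j + r) ∸ ones (take j x))
LevDist-onesTwos x j r |x|≤j+r x∌2 = LevDist-intro (EditSeq-onesTwos x j r |x|≤j+r)
  λ e → ≤-trans (lev-onesTwos-≥ x j r x∌2) (lev≤EditSeq e)

mainTheorem7 : (n n' j : ℕ) (s : List Sym)
    → 1 ≤ n → 1 ≤ n' → n' ≤ n → length s ≡ n'
    → All (λ c → c ≢ suc (suc zero)) s
    → 1 ≤ j → j ≤ n'
    → LevDist s (replicate j (suc zero) ++ replicate (n ∸ j) (suc (suc zero)))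
        (n ∸ ones (take j s))
mainTheorem7 n n' j s _ _ n'≤n refl s∌2 _ j≤n' =
  subst (λ m → LevDist s (onesTwos j (n ∸ j)) (m ∸ ones (take j s))) j+[n∸j]≡n
    (LevDist-onesTwos s j (n ∸ j) (subst (length s ≤_) (sym j+[n∸j]≡n) n'≤n) s∌2)
  where
  j+[n∸j]≡n : j + (n ∸ j) ≡ n
  j+[n∸j]≡n = m+[n∸m]≡n (≤-trans j≤n' n'≤n)
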